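{- Let $a$ be a rigid resource term that is a head-normal form and let $M$ be a $\lambda$-term with $a\in T_r(M)$. Then $M$ is a head-normal form.
   Context: Rigid resource terms: $a ::= x\mid \lambda x.a\mid \langle c\rangle\vec d\mid 0$, $\vec d=(d_1,\dots,d_n)$ a finite list of rigid terms. Every nonzero rigid term is $\lambda x_1\dots\lambda x_m.\langle\cdots\langle a'\rangle\vec b_1\cdots\rangle\vec b_n$ with $a'$ a variable (then it is a head-normal form) or a redex $\langle\lambda x.c\rangle\vec d$; $0$ is also a head-normal form. Rigid expansion: $T_r(x)=\{x\}$, $T_r(\lambda x.M)=\{\lambda x.a\mid a\in T_r(M)\}$, $T_r(PQ)=\{\langle c\rangle(d_1,\dots,d_n)\mid c\in T_r(P), n\ge0, d_i\in T_r(Q)\}$. A $\lambda$-term is a head-normal form if it is $\lambda x_1\dots\lambda x_m.yN_1\dots N_n$ with $y$ a variable. -}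

module Defs where

open import Data.Nat using (ℕ)
open import Data.List using (List; []; _∷_)
open import Data.List.Relation.Unary.All using (All)

Var : Set
Var = ℕ

data Λ : Set where
  var : Var → Λ
  lam : Var → Λ → Λ
  app : Λ → Λ → Λ

data Rigid : Set where
  rvar  : Var → Rigid
  rlam  : Var → Rigid → Rigid
  rapp  : Rigid → List Rigid → Rigid
  rzero : Rigid

data _∈Tr_ : Rigid → Λ → Set where
  tr-var : ∀ {x} → rvar x ∈Tr var x
  tr-lam : ∀ {x a M} → a ∈Tr M → rlam x a ∈Tr lam x M
  tr-app : ∀ {c ds P Q} → c ∈Tr P → All (_∈Tr Q) ds → rapp c ds ∈Tr app P Q

data RigidHeadVar : Rigid → Set where
  hv-var : ∀ {y} → RigidHeadVar (rvar y)
  hv-app : ∀ {c ds} → RigidHeadVar c → RigidHeadVar (rapp c ds)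

data RigidLamHeadVar : Rigid → Set where
  rl-body : ∀ {a} → RigidHeadVar a → RigidLamHeadVar a
  rl-lam  : ∀ {x a} → RigidLamHeadVar a → RigidLamHeadVar (rlam x a)

data RigidHNF : Rigid → Set where
  rh-zero : RigidHNF rzero
  rh-lhv  : ∀ {a} → RigidLamHeadVar a → RigidHNF a

data HeadVar : Λ → Set where
  hv-var : ∀ {y} → HeadVar (var y)
  hv-app : ∀ {P Q} → HeadVar P → HeadVar (app P Q)

data HNF : Λ → Set where
  h-body : ∀ {M} → HeadVar M → HNF M
  h-lam  : ∀ {x M} → HNF M → HNF (lam x M)

module Submission where

-- Rigid expansion is syntax-directed: a variable expands only a
-- variable, an abstraction only an abstraction, and an application
-- ⟨c⟩d⃗ only an application P Q with c ∈ Tr(P).  Hence the shape of a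
-- rigid head-normal form λx₁…λxₘ.⟨⋯⟨y⟩b⃗₁⋯⟩b⃗ₙ is copied along its spine
-- onto M, yielding λx₁…λxₘ.y N₁⋯Nₙ.

open import Data.Empty using (⊥)
open import Defs

headVar-reflect : ∀ {a M} → RigidHeadVar a → a ∈Tr M → HeadVar M
headVar-reflect hv-var     tr-var       = hv-var
headVar-reflect (hv-app h) (tr-app c _) = hv-app (headVar-reflect h c)

lamHeadVar-reflect : ∀ {a M} → RigidLamHeadVar a → a ∈Tr M → HNF M
lamHeadVar-reflect (rl-body h) t          = h-body (headVar-reflect h t)
lamHeadVar-reflect (rl-lam h)  (tr-lam t) = h-lam (lamHeadVar-reflect h t)

zero-notInExpansion : ∀ {M} → rzero ∈Tr M → ⊥
zero-notInExpansion ()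

mainTheorem11 : (a : Rigid) (M : Λ) → RigidHNF a → a ∈Tr M → HNF M
mainTheorem11 _ _ rh-zero   t with () ← zero-notInExpansion t
mainTheorem11 _ _ (rh-lhv h) t = lamHeadVar-reflect h t
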